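{- Let $n_1,n_2,k$ be positive integers with $k\le n_2$. Let $f:\mathbb{F}_2^{n_1+n_2}\to\mathbb{F}_2$ be given by $f(\mathbf{x},\mathbf{y})=\bigoplus_{\mathbf{a}\in\mathbb{F}_2^{n_1}}ac_{\mathbf{a}}(\mathbf{x})\cdot g_{\mathbf{a}}(\mathbf{y})$ with $g_{\mathbf{a}}:\mathbb{F}_2^{n_2}\to\mathbb{F}_2$, where $g_{\mathbf{1}_{n_1}}={\sf sym}^k_{n_2}$ and $g_{\mathbf{a}}=1$ for all $\mathbf{a}\in\mathbb{F}_2^{n_1}$ with $n_1>\mathrm{wt}(\mathbf{a})\ge n_1-k$ (the remaining $g_{\mathbf{a}}$ arbitrary). Then $f$ is $k$-th order sensitive.
   Context: $ac_{\mathbf{a}}(\mathbf{x})$ is the indicator of $\mathbf{x}=\mathbf{a}$, so $f(\mathbf{a},\mathbf{y})=g_{\mathbf{a}}(\mathbf{y})$. $\mathbf{1}_{n_1}$ is the all-ones vector, $\mathrm{wt}$ the Hamming weight. ${\sf sym}^k_{m}$ is the Boolean function on $m$ variables whose algebraic normal form is the XOR of all monomials of degree between $1$ and $k$. For $S$ a set of coordinates, $\mathbf{z}^{(S)}$ is $\mathbf{z}$ with those bits flipped; $f$ is $k$-th order sensitive if there is $\mathbf{z}$ with $f(\mathbf{z})\ne f(\mathbf{z}^{(S)})$ for all $S$ with $1\le|S|\le k$. -}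

module Defs where

open import Data.Bool using (Bool; true; false; _xor_; _∧_; not; if_then_else_)
open import Data.Nat using (ℕ; zero; suc; _+_; _≤_; _<_)
open import Data.Vec using (Vec; []; _∷_; splitAt; zipWith; foldr; replicate; count; map; _++_)
open import Data.List using (List; []; _∷_; concatMap)
import Data.List as L
open import Data.Bool.Properties using (T?)
open import Data.Product using (Σ; _×_; _,_; ∃; proj₁)
open import Relation.Binary.PropositionalEquality using (_≡_; _≢_)
open import Relation.Nullary using (Dec; yes; no; does)

-- F_2 is Bool with xor as addition and ∧ as multiplication.

allVecs : (n : ℕ) → List (Vec Bool n)
allVecs zero = [] ∷ []
allVecs (suc n) = concatMap (λ v → (false ∷ v) ∷ (true ∷ v) ∷ []) (allVecs n)

⨁ : {A : Set} → List A → (A → Bool) → Bool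
⨁ xs h = L.foldr (λ a acc → h a xor acc) false xs

wt : {n : ℕ} → Vec Bool n → ℕ
wt [] = 0
wt (true ∷ v) = suc (wt v)
wt (false ∷ v) = wt v

_==ᵥ_ : {n : ℕ} → Vec Bool n → Vec Bool n → Bool
[] ==ᵥ [] = true
(a ∷ u) ==ᵥ (b ∷ v) = not (a xor b) ∧ (u ==ᵥ v)

ac : {n : ℕ} → Vec Bool n → Vec Bool n → Bool
ac a x = x ==ᵥ a

-- monomial x^S = ∏_{i ∈ S} x_i  (S given as its characteristic vector)
monomial : {m : ℕ} → Vec Bool m → Vec Bool m → Bool
monomial [] [] = true
monomial (true ∷ S) (y ∷ ys) = y ∧ monomial S ys
monomial (false ∷ S) (y ∷ ys) = monomial S ys

inDegRange : ℕ → ℕ → Bool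
inDegRange k d = does (1 Data.Nat.≤? d) ∧ does (d Data.Nat.≤? k)

sym : (k m : ℕ) → Vec Bool m → Bool
sym k m y = ⨁ (allVecs m) (λ S → if inDegRange k (wt S) then monomial S y else false)

𝟏 : (n : ℕ) → Vec Bool n
𝟏 n = replicate n true

fFrom : (n₁ n₂ : ℕ) → (Vec Bool n₁ → Vec Bool n₂ → Bool) → Vec Bool (n₁ + n₂) → Bool
fFrom n₁ n₂ g z with splitAt n₁ z
... | x , y , _ = ⨁ (allVecs n₁) (λ a → ac a x ∧ g a y)

flip : {n : ℕ} → Vec Bool n → Vec Bool n → Vec Bool n
flip S z = zipWith _xor_ S z

KthOrderSensitive : {n : ℕ} → ℕ → (Vec Bool n → Bool) → Set
KthOrderSensitive {n} k f =
  ∃ λ (z : Vec Bool n) → (S : Vec Bool n) → 1 ≤ wt S → wt S ≤ k → f z ≢ f (flip S z)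

-- At z = (𝟏, 𝟎) we have f z = sym(𝟎) = 0. Flip a set S = (S₁, S₂) of at most k
-- coordinates. If S₁ = ∅ the value becomes sym(S₂), and a vector y of weight at most k
-- satisfies sym y = ⨁_{T ≠ ∅} y^T = ∏ (1 + yᵢ) + 1 = [y ≠ 0], so the value is 1.
-- Otherwise the x-part is the complement of S₁, of weight in [n₁ − k, n₁), where g ≡ 1.
module Submission where

open import Defs
open import Algebra using (CommutativeRing)
open import Data.Bool using (Bool; true; false; _xor_; _∧_; not; if_then_else_)
open import Data.Bool.Properties
  using (xor-identityˡ; xor-identityʳ; xor-comm; xor-assoc; xor-same; true-xor; xor-∧-commutativeRing)
open import Data.Nat using (ℕ; zero; suc; _≤_; _<_; _+_; _∸_; z≤n; s≤s; _≤?_)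
open import Data.Nat.Properties
  using (≤-trans; ≤-reflexive; +-suc; m≤m+n; m<m+n; ∸-monoʳ-≤; m+n∸n≡m; n≤1+n)
open import Data.Vec using (Vec; []; _∷_; _++_; replicate; zipWith; splitAt)
open import Data.Vec.Properties
  using (zipWith-++; zipWith-identityˡ; zipWith-identityʳ; ++-injectiveˡ; ++-injectiveʳ)
open import Data.List using (List; concatMap)
import Data.List as L
open import Data.Product using (_,_)
open import Relation.Binary.PropositionalEquality
  using (_≡_; _≢_; refl; trans; cong; cong₂; subst; module ≡-Reasoning)
  renaming (sym to ≡-sym)
open import Relation.Nullary using (does)
open import Relation.Nullary.Decidable using (dec-true)
open import Algebra.Properties.CommutativeSemigroup
  (CommutativeRing.+-commutativeSemigroup xor-∧-commutativeRing) using (interchange)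

⨁-cong : ∀ {A : Set} (xs : List A) {p q : A → Bool} →
         (∀ a → p a ≡ q a) → ⨁ xs p ≡ ⨁ xs q
⨁-cong L.[]       p≡q = refl
⨁-cong (x L.∷ xs) p≡q = cong₂ _xor_ (p≡q x) (⨁-cong xs p≡q)

⨁-false : ∀ {A : Set} (xs : List A) → ⨁ xs (λ _ → false) ≡ false
⨁-false L.[]       = refl
⨁-false (x L.∷ xs) = ⨁-false xs

⨁-xor : ∀ {A : Set} (xs : List A) (p q : A → Bool) →
        ⨁ xs (λ a → p a xor q a) ≡ ⨁ xs p xor ⨁ xs q
⨁-xor L.[]       p q = refl
⨁-xor (x L.∷ xs) p q =
  trans (cong ((p x xor q x) xor_) (⨁-xor xs p q)) (interchange (p x) (q x) (⨁ xs p) (⨁ xs q))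

⨁-xor-false : ∀ {A : Set} (xs : List A) (p : A → Bool) →
              ⨁ xs (λ a → p a xor false) ≡ ⨁ xs p
⨁-xor-false xs p = ⨁-cong xs (λ a → xor-identityʳ (p a))

⨁-concatMap-pair : ∀ {A B : Set} (xs : List A) (u v : A → B) (h : B → Bool) →
                   ⨁ (concatMap (λ a → u a L.∷ v a L.∷ L.[]) xs) h
                   ≡ ⨁ xs (λ a → h (u a) xor h (v a))
⨁-concatMap-pair L.[]       u v h = refl
⨁-concatMap-pair (x L.∷ xs) u v h =
  trans (cong (λ t → h (u x) xor (h (v x) xor t)) (⨁-concatMap-pair xs u v h))
        (≡-sym (xor-assoc (h (u x)) (h (v x)) _))

⨁-allVecs-suc : ∀ n (h : Vec Bool (suc n) → Bool) →
                ⨁ (allVecs (suc n)) h ≡ ⨁ (allVecs n) (λ v → h (false ∷ v) xor h (true ∷ v))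
⨁-allVecs-suc n = ⨁-concatMap-pair (allVecs n) (false ∷_) (true ∷_)

⨁-ac : ∀ n (x : Vec Bool n) (h : Vec Bool n → Bool) →
       ⨁ (allVecs n) (λ a → ac a x ∧ h a) ≡ h x
⨁-ac zero    []          h = xor-identityʳ (h [])
⨁-ac (suc n) (false ∷ x) h =
  trans (⨁-allVecs-suc n (λ a → ac a (false ∷ x) ∧ h a))
        (trans (⨁-xor-false (allVecs n) (λ v → ac v x ∧ h (false ∷ v)))
               (⨁-ac n x (λ v → h (false ∷ v))))
⨁-ac (suc n) (true ∷ x)  h =
  trans (⨁-allVecs-suc n (λ a → ac a (true ∷ x) ∧ h a)) (⨁-ac n x (λ v → h (true ∷ v)))

zeros : ∀ n → Vec Bool n
zeros n = replicate n false

==ᵥ-refl : ∀ {m} (v : Vec Bool m) → (v ==ᵥ v) ≡ true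
==ᵥ-refl []          = refl
==ᵥ-refl (true ∷ v)  = ==ᵥ-refl v
==ᵥ-refl (false ∷ v) = ==ᵥ-refl v

wt≡0⇒zeros : ∀ {m} (v : Vec Bool m) → wt v ≡ 0 → v ≡ zeros m
wt≡0⇒zeros []          _   = refl
wt≡0⇒zeros (false ∷ v) wt0 = cong (false ∷_) (wt≡0⇒zeros v wt0)

wt>0⇒≢zeros : ∀ {m} (v : Vec Bool m) → 0 < wt v → (v ==ᵥ zeros m) ≡ false
wt>0⇒≢zeros (true ∷ v)  _   = refl
wt>0⇒≢zeros (false ∷ v) wt+ = wt>0⇒≢zeros v wt+

⨁-==ᵥzeros : ∀ m → ⨁ (allVecs m) (_==ᵥ zeros m) ≡ true
⨁-==ᵥzeros zero    = refl
⨁-==ᵥzeros (suc m) =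
  trans (⨁-allVecs-suc m (_==ᵥ zeros (suc m)))
        (trans (⨁-xor-false (allVecs m) (_==ᵥ zeros m)) (⨁-==ᵥzeros m))

monomial-zeros : ∀ {m} (y : Vec Bool m) → monomial (zeros m) y ≡ true
monomial-zeros []      = refl
monomial-zeros (_ ∷ y) = monomial-zeros y

-- Over F₂, ⨁_T y^T = ∏ᵢ (1 + yᵢ).
⨁-monomial : ∀ m (y : Vec Bool m) →
             ⨁ (allVecs m) (λ T → monomial T y) ≡ (y ==ᵥ zeros m)
⨁-monomial zero    []          = refl
⨁-monomial (suc m) (false ∷ y) =
  trans (⨁-allVecs-suc m (λ T → monomial T (false ∷ y)))
        (trans (⨁-xor-false (allVecs m) (λ T → monomial T y)) (⨁-monomial m y))
⨁-monomial (suc m) (true ∷ y)  =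
  trans (⨁-allVecs-suc m (λ T → monomial T (true ∷ y)))
        (trans (⨁-cong (allVecs m) (λ T → xor-same (monomial T y))) (⨁-false (allVecs m)))

monomial-wt : ∀ {m} (T y : Vec Bool m) → monomial T y ≡ true → wt T ≤ wt y
monomial-wt []          []          _   = z≤n
monomial-wt (true ∷ T)  (true ∷ y)  yᵀ = s≤s (monomial-wt T y yᵀ)
monomial-wt (false ∷ T) (true ∷ y)  yᵀ = ≤-trans (monomial-wt T y yᵀ) (n≤1+n _)
monomial-wt (false ∷ T) (false ∷ y) yᵀ = monomial-wt T y yᵀ

if-then-false : ∀ (b m : Bool) → (m ≡ true → b ≡ true) → (if b then m else false) ≡ m
if-then-false true  m     _   = refl
if-then-false false true  m⇒b = m⇒b refl
if-then-false false false _   = refl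

-- When wt y ≤ k the degree cap never bites: every monomial with y^T = 1 has wt T ≤ k,
-- so only the constant monomial is missing from the full expansion.
sym-term-light : ∀ {k m} (y : Vec Bool m) → wt y ≤ k → (T : Vec Bool m) →
                 (if inDegRange k (wt T) then monomial T y else false)
                 ≡ monomial T y xor (T ==ᵥ zeros m)
sym-term-light {k} {m} y wy≤k T with wt T in wtT
... | zero  rewrite wt≡0⇒zeros T wtT | monomial-zeros y | ==ᵥ-refl (zeros m) = refl
... | suc d rewrite wt>0⇒≢zeros T (subst (0 <_) (≡-sym wtT) (s≤s z≤n)) =
  trans (if-then-false _ (monomial T y) degree≤k) (≡-sym (xor-identityʳ _))
  where
  degree≤k : monomial T y ≡ true → does (suc d ≤? k) ≡ true
  degree≤k yᵀ =
    dec-true (suc d ≤? k) (≤-trans (subst (_≤ wt y) wtT (monomial-wt T y yᵀ)) wy≤k)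

sym-light : ∀ k m (y : Vec Bool m) → wt y ≤ k → sym k m y ≡ not (y ==ᵥ zeros m)
sym-light k m y wy≤k = begin
  sym k m y
    ≡⟨ ⨁-cong (allVecs m) (sym-term-light y wy≤k) ⟩
  ⨁ (allVecs m) (λ T → monomial T y xor (T ==ᵥ zeros m))
    ≡⟨ ⨁-xor (allVecs m) (λ T → monomial T y) (_==ᵥ zeros m) ⟩
  ⨁ (allVecs m) (λ T → monomial T y) xor ⨁ (allVecs m) (_==ᵥ zeros m)
    ≡⟨ cong₂ _xor_ (⨁-monomial m y) (⨁-==ᵥzeros m) ⟩
  (y ==ᵥ zeros m) xor true
    ≡⟨ trans (xor-comm _ true) (true-xor _) ⟩
  not (y ==ᵥ zeros m) ∎
  where open ≡-Reasoning

sym-zeros : ∀ k m → sym k m (zeros m) ≡ false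
sym-zeros k m = trans (sym-light k m (zeros m) (wt-zeros m)) (cong not (==ᵥ-refl (zeros m)))
  where
  wt-zeros : ∀ m → wt (zeros m) ≤ k
  wt-zeros zero    = z≤n
  wt-zeros (suc m) = wt-zeros m

sym-nonzero : ∀ k m (y : Vec Bool m) → 0 < wt y → wt y ≤ k → sym k m y ≡ true
sym-nonzero k m y wy>0 wy≤k = trans (sym-light k m y wy≤k) (cong not (wt>0⇒≢zeros y wy>0))

fFrom-++ : ∀ {n₁ n₂} (g : Vec Bool n₁ → Vec Bool n₂ → Bool)
           (x : Vec Bool n₁) (y : Vec Bool n₂) → fFrom n₁ n₂ g (x ++ y) ≡ g x y
fFrom-++ {n₁} g x y with splitAt n₁ (x ++ y)
... | x′ , y′ , eq rewrite ++-injectiveˡ x x′ eq | ++-injectiveʳ x x′ eq =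
  ⨁-ac n₁ x′ (λ a → g a y′)

wt-++ : ∀ {m n} (u : Vec Bool m) (v : Vec Bool n) → wt (u ++ v) ≡ wt u + wt v
wt-++ []          v = refl
wt-++ (true ∷ u)  v = cong suc (wt-++ u v)
wt-++ (false ∷ u) v = wt-++ u v

wt-flip-𝟏 : ∀ {m} (S : Vec Bool m) → wt (flip S (𝟏 m)) + wt S ≡ m
wt-flip-𝟏 []          = refl
wt-flip-𝟏 (true ∷ S)  = trans (+-suc _ (wt S)) (cong suc (wt-flip-𝟏 S))
wt-flip-𝟏 (false ∷ S) = cong suc (wt-flip-𝟏 S)

wt-flip-𝟏-< : ∀ {m} (S : Vec Bool m) → 0 < wt S → wt (flip S (𝟏 m)) < m
wt-flip-𝟏-< S wS>0 = subst (wt (flip S (𝟏 _)) <_) (wt-flip-𝟏 S) (m<m+n _ wS>0)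

∸-≤-wt-flip-𝟏 : ∀ {m k} (S : Vec Bool m) → wt S ≤ k → m ∸ k ≤ wt (flip S (𝟏 m))
∸-≤-wt-flip-𝟏 {m} S wS≤k = ≤-trans (∸-monoʳ-≤ m wS≤k) (≤-reflexive (begin
  m ∸ wt S                          ≡⟨ cong (_∸ wt S) (≡-sym (wt-flip-𝟏 S)) ⟩
  wt (flip S (𝟏 m)) + wt S ∸ wt S   ≡⟨ m+n∸n≡m _ (wt S) ⟩
  wt (flip S (𝟏 m))                 ∎))
  where open ≡-Reasoning

flip-zeros : ∀ {m} (S : Vec Bool m) → flip S (zeros m) ≡ S
flip-zeros = zipWith-identityʳ xor-identityʳ

flip-by-zeros : ∀ {m} (v : Vec Bool m) → flip (zeros m) v ≡ v
flip-by-zeros = zipWith-identityˡ xor-identityˡ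

mainTheorem15 : (n₁ n₂ k : ℕ) → 1 ≤ n₁ → 1 ≤ n₂ → 1 ≤ k → k ≤ n₂ →
    (g : Vec Bool n₁ → Vec Bool n₂ → Bool) →
    ((y : Vec Bool n₂) → g (𝟏 n₁) y ≡ sym k n₂ y) →
    ((a : Vec Bool n₁) → wt a < n₁ → n₁ ∸ k ≤ wt a → (y : Vec Bool n₂) → g a y ≡ true) →
    KthOrderSensitive k (fFrom n₁ n₂ g)
mainTheorem15 n₁ n₂ k _ _ _ _ g g𝟏 g-heavy = z , flip-changes-f
  where
  open ≡-Reasoning
  z : Vec Bool (n₁ + n₂)
  z = 𝟏 n₁ ++ zeros n₂

  f : Vec Bool (n₁ + n₂) → Bool
  f = fFrom n₁ n₂ g

  f-z : f z ≡ false
  f-z = trans (fFrom-++ g (𝟏 n₁) (zeros n₂)) (trans (g𝟏 (zeros n₂)) (sym-zeros k n₂))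

  g-flipped : ∀ S₁ S₂ → 0 < wt S₁ + wt S₂ → wt S₁ + wt S₂ ≤ k →
              g (flip S₁ (𝟏 n₁)) S₂ ≡ true
  g-flipped S₁ S₂ wS>0 wS≤k with wt S₁ in wS₁
  ... | zero rewrite wt≡0⇒zeros S₁ wS₁ | flip-by-zeros (𝟏 n₁) =
    trans (g𝟏 S₂) (sym-nonzero k n₂ S₂ wS>0 wS≤k)
  ... | suc w = g-heavy _ (wt-flip-𝟏-< S₁ wS₁>0) (∸-≤-wt-flip-𝟏 S₁ wS₁≤k) S₂
    where
    wS₁>0 : 0 < wt S₁
    wS₁>0 = subst (0 <_) (≡-sym wS₁) (s≤s z≤n)
    wS₁≤k : wt S₁ ≤ k
    wS₁≤k = subst (_≤ k) (≡-sym wS₁) (≤-trans (m≤m+n (suc w) (wt S₂)) wS≤k)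

  flip-changes-f : ∀ S → 1 ≤ wt S → wt S ≤ k → f z ≢ f (flip S z)
  flip-changes-f S wS>0 wS≤k with splitAt n₁ S
  ... | S₁ , S₂ , refl rewrite wt-++ S₁ S₂ = λ same → false≢true (begin
    false
      ≡⟨ ≡-sym f-z ⟩
    f z
      ≡⟨ same ⟩
    f (flip (S₁ ++ S₂) z)
      ≡⟨ cong f (zipWith-++ _xor_ S₁ S₂ (𝟏 n₁) (zeros n₂)) ⟩
    f (flip S₁ (𝟏 n₁) ++ flip S₂ (zeros n₂))
      ≡⟨ cong (λ y → f (flip S₁ (𝟏 n₁) ++ y)) (flip-zeros S₂) ⟩
    f (flip S₁ (𝟏 n₁) ++ S₂)
      ≡⟨ fFrom-++ g (flip S₁ (𝟏 n₁)) S₂ ⟩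
    g (flip S₁ (𝟏 n₁)) S₂
      ≡⟨ g-flipped S₁ S₂ wS>0 wS≤k ⟩
    true ∎)
    where
    false≢true : false ≢ true
    false≢true ()
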